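{- For every non-negative integer $n$, $T(n) = 2$ if and only if $g(n) = f(n)$.
   Context: For a non-negative integer $n$, $g(n)$ is the least integer $k$ such that there exists a strictly increasing sequence of integers $n = a_1 < \cdots < a_t = k$ ($t \geq 1$) whose product is a perfect square; such a sequence ending at $g(n)$ is a corresponding sequence for $g(n)$. $T(n)$ is the least length $t$ of a corresponding sequence for $g(n)$. $f(n)$ is the least integer $k > n$ such that $nk$ is a perfect square. -}

module Defs where

open import Data.Nat using (ℕ; zero; suc; _*_; _<_; _≤_)
open import Data.List using (List; []; _∷_; length)
open import Data.Nat.ListAction using (product)
open import Data.List.Relation.Unary.Linked using (Linked)
open import Data.Product using (Σ; ∃; _×_)
open import Relation.Binary.PropositionalEquality using (_≡_)

IsSquare : ℕ → Set
IsSquare m = ∃ λ r → r * r ≡ m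

lastOf : ℕ → List ℕ → ℕ
lastOf a []       = a
lastOf a (b ∷ bs) = lastOf b bs

-- CorrSeq n k t : there is a strictly increasing sequence
--   n = a_1 < ... < a_t = k   (represented as the list  n ∷ as)
-- of length t whose product is a perfect square.
CorrSeq : ℕ → ℕ → ℕ → Set
CorrSeq n k t = Σ (List ℕ) λ as →
  Linked _<_ (n ∷ as) × lastOf n as ≡ k × length (n ∷ as) ≡ t × IsSquare (product (n ∷ as))

Reachable : ℕ → ℕ → Set
Reachable n k = ∃ λ t → CorrSeq n k t

IsG : ℕ → ℕ → Set
IsG n k = Reachable n k × (∀ k′ → Reachable n k′ → k ≤ k′)

IsT : ℕ → ℕ → Set
IsT n t = ∃ λ k → IsG n k × CorrSeq n k t × (∀ t′ → CorrSeq n k t′ → t ≤ t′)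

IsF : ℕ → ℕ → Set
IsF n k = n < k × IsSquare (n * k) × (∀ k′ → n < k′ → IsSquare (n * k′) → k ≤ k′)

-- A corresponding sequence of length 2 is exactly a pair n < k with n k a square,
-- so f(n) is reachable (g(n) ≤ f(n)), and T(n) = 2 forces g(n) to be such a k
-- (f(n) ≤ g(n)). Conversely, if g(n) = f(n) > n then the pair (n, f(n)) bounds
-- T(n) by 2, while any sequence ending above n has length at least 2.
module Submission where

open import Defs
open import Data.Nat using (ℕ; _*_; _<_; _≤_; s≤s; z≤n)
open import Data.Nat.Properties using (≤-antisym; *-identityʳ; <-irrefl)
open import Data.List using ([]; _∷_)
open import Data.List.Relation.Unary.Linked using ([-]; _∷_)
open import Data.Product using (_×_; _,_)
open import Data.Empty using (⊥-elim)
open import Relation.Binary.PropositionalEquality using (_≡_; refl; sym; subst)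

IsG-unique : ∀ {n g g′} → IsG n g → IsG n g′ → g ≡ g′
IsG-unique (r , min) (r′ , min′) = ≤-antisym (min _ r′) (min′ _ r)

pair⇒CorrSeq₂ : ∀ {n k} → n < k → IsSquare (n * k) → CorrSeq n k 2
pair⇒CorrSeq₂ {n} {k} n<k sq =
  (k ∷ []) , (n<k ∷ [-]) , refl , refl , subst (λ m → IsSquare (n * m)) (sym (*-identityʳ k)) sq

CorrSeq₂⇒pair : ∀ {n k} → CorrSeq n k 2 → n < k × IsSquare (n * k)
CorrSeq₂⇒pair {n} ((b ∷ []) , (n<b ∷ [-]) , refl , refl , sq) =
  n<b , subst (λ m → IsSquare (n * m)) (*-identityʳ b) sq

CorrSeq-ascending⇒2≤length : ∀ {n k t} → n < k → CorrSeq n k t → 2 ≤ t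
CorrSeq-ascending⇒2≤length n<k ([] , _ , refl , refl , _) = ⊥-elim (<-irrefl refl n<k)
CorrSeq-ascending⇒2≤length _ ((_ ∷ _) , _ , _ , refl , _) = s≤s (s≤s z≤n)

g≤f : ∀ {n g f} → IsG n g → IsF n f → g ≤ f
g≤f (_ , ming) (n<f , sq , _) = ming _ (2 , pair⇒CorrSeq₂ n<f sq)

lemma3p4 : ∀ (n g f t : ℕ) → IsG n g → IsF n f → IsT n t →
    ((t ≡ 2 → g ≡ f) × (g ≡ f → t ≡ 2))
lemma3p4 n g f t isG isF@(n<f , sqf , minf) (k , isGk , seq , mint)
  with IsG-unique isGk isG
... | refl = T≡2⇒g≡f , g≡f⇒T≡2
  where
  T≡2⇒g≡f : t ≡ 2 → g ≡ f
  T≡2⇒g≡f refl with CorrSeq₂⇒pair seq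
  ... | n<g , sqg = ≤-antisym (g≤f isG isF) (minf g n<g sqg)

  g≡f⇒T≡2 : g ≡ f → t ≡ 2
  g≡f⇒T≡2 refl = ≤-antisym (mint 2 (pair⇒CorrSeq₂ n<f sqf))
                           (CorrSeq-ascending⇒2≤length n<f seq)
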